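{- Let $\mathcal{A}$ be the space of abelian group multiplication tables on $\mathbb{N}$ with identity $1$, and $\mathcal{A}'$ the space of subgroups of $\mathbb{Z}^{(\mathbb{N})}$. The map $\Phi:\mathcal{A}\to\mathcal{A}'$, $\Phi(A)=\{x\in\mathbb{Z}^{(\mathbb{N})}:\ \prod_{n\in\mathbb{N}}n^{x(n)}=1 \text{ holds in } \widetilde A\}$, is a topological embedding (injective, continuous, and a homeomorphism onto its image).
   Context: $\mathbb{N}=\{1,2,3,\dots\}$. $\mathcal{G}\subseteq\mathbb{N}^{\mathbb{N}\times\mathbb{N}}$ (product of discrete spaces) is the subspace of those $A$ such that $(i,j)\mapsto A(i,j)$ is the multiplication of a group on $\mathbb{N}$ with identity $1$; for $A\in\mathcal{G}$, $\widetilde A$ is that group (written multiplicatively). $\mathcal{A}=\{A\in\mathcal{G}:\widetilde A\text{ abelian}\}$ with the subspace topology. $\mathbb{Z}^{(\mathbb{N})}$ is the group of finitely supported functions $\mathbb{N}\to\mathbb{Z}$; $\mathcal{A}'$ is the set of its subgroups with the subspace topology inherited from the Cantor space $2^{\mathbb{Z}^{(\mathbb{N})}}$ (identifying subsets with indicator functions). In the definition of $\Phi$, $n^{x(n)}$ is the $x(n)$-th power of the element $n$ in $\widetilde A$, and the product is finite since $x$ has finite support. -}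

module Defs where

open import Data.Nat using (ℕ; zero; suc; _≤_)
open import Data.Integer using (ℤ; +_; -[1+_])
open import Data.Product using (Σ; ∃; _×_; _,_; proj₁)
open import Data.List using (List)
open import Data.List.Relation.Unary.All using (All)
open import Function.Bundles using (_⇔_)
open import Relation.Binary.PropositionalEquality using (_≡_)

-- CONVENTION: the paper's ℕ = {1,2,3,…} is encoded by Agda's ℕ via the
-- shift k ↦ k+1.  So the Agda number k stands for the paper's k+1, and the
-- group identity 1 is the Agda number 0.

Table : Set
Table = ℕ → ℕ → ℕ

record IsAbTable (A : Table) : Set where
  field
    assoc    : ∀ a b c → A (A a b) c ≡ A a (A b c)
    identityˡ : ∀ a → A 0 a ≡ a
    identityʳ : ∀ a → A a 0 ≡ a
    inverse  : ∀ a → Σ ℕ (λ b → (A a b ≡ 0) × (A b a ≡ 0))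
    comm     : ∀ a b → A a b ≡ A b a

record FinSupp : Set where
  field
    fn      : ℕ → ℤ
    bound   : ℕ
    vanish  : ∀ n → bound ≤ n → fn n ≡ + 0
open FinSupp public

module _ (A : Table) (hA : IsAbTable A) where
  inv : ℕ → ℕ
  inv a = proj₁ (IsAbTable.inverse hA a)

  powℕ : ℕ → ℕ → ℕ
  powℕ g zero    = 0
  powℕ g (suc m) = A (powℕ g m) g

  pow : ℕ → ℤ → ℕ
  pow g (+ m)      = powℕ g m
  pow g -[1+ m ]   = powℕ (inv g) (suc m)

  -- ∏_{n < N} n^{x(n)}  (order irrelevant: Ã is abelian)
  prodUpTo : (ℕ → ℤ) → ℕ → ℕ
  prodUpTo x zero    = 0
  prodUpTo x (suc N) = A (prodUpTo x N) (pow N (x N))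

  -- ∏_{n ∈ ℕ} n^{x(n)}; all factors beyond the support bound are trivial.
  prod : FinSupp → ℕ
  prod x = prodUpTo (fn x) (bound x)

  Φ : FinSupp → Set
  Φ x = prod x ≡ 0

𝒜 : Set
𝒜 = Σ Table IsAbTable

Φ' : 𝒜 → FinSupp → Set
Φ' (A , hA) = Φ A hA

-- Agreement of two tables on a finite set of coordinates (basic open sets of
-- the product of discrete spaces ℕ^(ℕ×ℕ)).
AgreeOn : List (ℕ × ℕ) → Table → Table → Set
AgreeOn ps A B = All (λ { (i , j) → A i j ≡ B i j }) ps

-- Agreement of two subsets of ℤ^(ℕ) on a finite set of points (basic open
-- sets of the Cantor space 2^(ℤ^(ℕ))).
AgreeAt : List FinSupp → (FinSupp → Set) → (FinSupp → Set) → Set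
AgreeAt xs S T = All (λ x → S x ⇔ T x) xs

PhiInjective : Set
PhiInjective = ∀ (A B : 𝒜) → (∀ x → Φ' A x ⇔ Φ' B x) →
               ∀ i j → proj₁ A i j ≡ proj₁ B i j

PhiContinuous : Set
PhiContinuous = ∀ (A : 𝒜) (xs : List FinSupp) →
  ∃ λ (ps : List (ℕ × ℕ)) → ∀ (B : 𝒜) →
    AgreeOn ps (proj₁ A) (proj₁ B) → AgreeAt xs (Φ' A) (Φ' B)

PhiInverseContinuous : Set
PhiInverseContinuous = ∀ (A : 𝒜) (ps : List (ℕ × ℕ)) →
  ∃ λ (xs : List FinSupp) → ∀ (B : 𝒜) →
    AgreeAt xs (Φ' A) (Φ' B) → AgreeOn ps (proj₁ A) (proj₁ B)

IsTopEmbeddingΦ : Set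
IsTopEmbeddingΦ = PhiInjective × PhiContinuous × PhiInverseContinuous

-- The relator eᵢ + eⱼ − eₖ ∈ ℤ^(ℕ) evaluates in Ã to i·j·k⁻¹, so it lies in Φ(A)
-- exactly when A(i,j) = k. Thus each entry A(i,j) is determined by whether a single
-- point of ℤ^(ℕ) lies in Φ(A), which gives injectivity and the continuity of the
-- inverse. Conversely, computing ∏ n^{x(n)} in Ã reads only finitely many entries of
-- the table, so whether a fixed x lies in Φ(A) depends on finitely many coordinates
-- of A, which is the continuity of Φ.
module Submission where

open import Defs
open import Level using (0ℓ)
open import Algebra.Bundles using (AbelianGroup)
import Algebra.Properties.AbelianGroup as AbelianGroupProperties
import Algebra.Properties.CommutativeSemigroup as CommutativeSemigroupProperties
import Algebra.Properties.Group as GroupProperties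
open import Data.Empty using (⊥-elim)
open import Data.Integer using (ℤ; +_; -[1+_]; _+_; _-_)
open import Data.List using (List; []; _∷_; _++_; map; concatMap)
open import Data.List.Relation.Unary.All as All using ([]; _∷_)
open import Data.List.Relation.Unary.All.Properties using (++⁻ˡ; ++⁻ʳ; map⁻; concat⁻)
open import Data.Nat using (ℕ; zero; suc; _<_; _≤_; _⊔_; s≤s)
open import Data.Nat.Properties using (_≟_; ≤-refl; ≤-trans; n≤1+n; <-irrefl; ≤∧≢⇒<; m≤m⊔n; m≤n⊔m)
open import Data.Product using (_×_; _,_; proj₁; proj₂)
open import Function using (id; _∘_)
open import Function.Bundles using (_⇔_; mk⇔; Equivalence)
open import Relation.Nullary using (yes; no)
open import Relation.Binary.PropositionalEquality

module _ {A : Table} (hA : IsAbTable A) where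

  abelianGroup : AbelianGroup 0ℓ 0ℓ
  abelianGroup = record
    { _≈_ = _≡_
    ; _∙_ = A
    ; ε = 0
    ; _⁻¹ = inv A hA
    ; isAbelianGroup = record
      { isGroup = record
        { isMonoid = record
          { isSemigroup = record
            { isMagma = record { isEquivalence = isEquivalence ; ∙-cong = cong₂ A }
            ; assoc = assoc
            }
          ; identity = identityˡ , identityʳ
          }
        ; inverse = (λ a → proj₂ (proj₂ (inverse a))) , (λ a → proj₁ (proj₂ (inverse a)))
        ; ⁻¹-cong = cong (inv A hA)
        }
      ; comm = comm
      }
    }
    where open IsAbTable hA

𝟙[_] : ℕ → ℕ → ℤ
𝟙[ i ] n with n ≟ i
... | yes _ = + 1
... | no _  = + 0

onlyAt : ℕ → (ℕ → ℕ) → ℕ → ℕ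
onlyAt i u n with n ≟ i
... | yes _ = u n
... | no _  = 0

𝟙-outside : ∀ {i n} → i < n → 𝟙[ i ] n ≡ + 0
𝟙-outside {i} {n} i<n with n ≟ i
... | yes refl = ⊥-elim (<-irrefl refl i<n)
... | no _     = refl

⊔₃-upper : ∀ i j k → i ≤ i ⊔ j ⊔ k × j ≤ i ⊔ j ⊔ k × k ≤ i ⊔ j ⊔ k
⊔₃-upper i j k = ≤-trans (m≤m⊔n i j) (m≤m⊔n (i ⊔ j) k)
               , ≤-trans (m≤n⊔m i j) (m≤m⊔n (i ⊔ j) k)
               , m≤n⊔m (i ⊔ j) k

relator : ℕ → ℕ → ℕ → FinSupp
relator i j k = record
  { fn     = λ n → 𝟙[ i ] n + 𝟙[ j ] n - 𝟙[ k ] n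
  ; bound  = suc (i ⊔ j ⊔ k)
  ; vanish = λ n m<n → let i≤m , j≤m , k≤m = ⊔₃-upper i j k in cong₂ _-_
      (cong₂ _+_ (𝟙-outside (≤-trans (s≤s i≤m) m<n)) (𝟙-outside (≤-trans (s≤s j≤m) m<n)))
      (𝟙-outside (≤-trans (s≤s k≤m) m<n))
  }

module _ {A : Table} (hA : IsAbTable A) where

  open AbelianGroup (abelianGroup hA)
    using (_∙_; ε; _⁻¹; identityˡ; identityʳ; inverseʳ; commutativeSemigroup; group)
  open AbelianGroupProperties (abelianGroup hA) using (xyx⁻¹≈y)
  open CommutativeSemigroupProperties commutativeSemigroup using (interchange)
  open GroupProperties group using (x∙y⁻¹≈ε⇒x≈y; x≈y⇒x∙y⁻¹≈ε)

  ∏< : (ℕ → ℕ) → ℕ → ℕ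
  ∏< u zero    = ε
  ∏< u (suc N) = ∏< u N ∙ u N

  prodUpTo≡∏< : ∀ x N → prodUpTo A hA x N ≡ ∏< (λ n → pow A hA n (x n)) N
  prodUpTo≡∏< x zero    = refl
  prodUpTo≡∏< x (suc N) = cong (_∙ pow A hA N (x N)) (prodUpTo≡∏< x N)

  ∏<-cong : ∀ {u v} → (∀ n → u n ≡ v n) → ∀ N → ∏< u N ≡ ∏< v N
  ∏<-cong u≗v zero    = refl
  ∏<-cong u≗v (suc N) = cong₂ _∙_ (∏<-cong u≗v N) (u≗v N)

  ∏<-distrib-∙ : ∀ u v N → ∏< (λ n → u n ∙ v n) N ≡ ∏< u N ∙ ∏< v N
  ∏<-distrib-∙ u v zero    = sym (identityˡ ε)
  ∏<-distrib-∙ u v (suc N) = trans (cong (_∙ (u N ∙ v N)) (∏<-distrib-∙ u v N)) (interchange _ _ _ _)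

  ∏<-onlyAt-≤ : ∀ i u N → N ≤ i → ∏< (onlyAt i u) N ≡ ε
  ∏<-onlyAt-≤ i u zero    _   = refl
  ∏<-onlyAt-≤ i u (suc N) N<i with N ≟ i
  ... | yes refl = ⊥-elim (<-irrefl refl N<i)
  ... | no _     = trans (identityʳ _) (∏<-onlyAt-≤ i u N (≤-trans (n≤1+n N) N<i))

  ∏<-onlyAt : ∀ i u N → i < N → ∏< (onlyAt i u) N ≡ u i
  ∏<-onlyAt i u (suc N) (s≤s i≤N) with N ≟ i
  ... | yes refl = trans (cong (_∙ u N) (∏<-onlyAt-≤ N u N ≤-refl)) (identityˡ _)
  ... | no N≢i   = trans (identityʳ _) (∏<-onlyAt i u N (≤∧≢⇒< i≤N (N≢i ∘ sym)))

  pow-relator : ∀ i j k n → pow A hA n (fn (relator i j k) n)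
              ≡ onlyAt i id n ∙ onlyAt j id n ∙ onlyAt k _⁻¹ n
  pow-relator i j k n with n ≟ i | n ≟ j | n ≟ k
  ... | yes _ | yes _ | yes _ = trans (identityˡ n) (sym (xyx⁻¹≈y n n))
  ... | yes _ | yes _ | no _  = trans (cong (_∙ n) (identityˡ n)) (sym (identityʳ _))
  ... | yes _ | no _  | yes _ = sym (trans (cong (_∙ n ⁻¹) (identityʳ n)) (inverseʳ n))
  ... | yes _ | no _  | no _  = trans (identityˡ n) (sym (trans (identityʳ _) (identityʳ n)))
  ... | no _  | yes _ | yes _ = sym (trans (cong (_∙ n ⁻¹) (identityˡ n)) (inverseʳ n))
  ... | no _  | yes _ | no _  = sym (identityʳ _)
  ... | no _  | no _  | yes _ = cong (_∙ n ⁻¹) (sym (identityˡ ε))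
  ... | no _  | no _  | no _  = sym (trans (identityʳ _) (identityˡ ε))

  prod-relator : ∀ i j k → prod A hA (relator i j k) ≡ i ∙ j ∙ k ⁻¹
  prod-relator i j k with ⊔₃-upper i j k
  ... | i≤m , j≤m , k≤m = begin
    prodUpTo A hA (fn (relator i j k)) N
      ≡⟨ prodUpTo≡∏< _ N ⟩
    ∏< (λ n → pow A hA n (fn (relator i j k) n)) N
      ≡⟨ ∏<-cong (pow-relator i j k) N ⟩
    ∏< (λ n → δᵢ n ∙ δⱼ n ∙ δₖ⁻¹ n) N
      ≡⟨ ∏<-distrib-∙ _ δₖ⁻¹ N ⟩
    ∏< (λ n → δᵢ n ∙ δⱼ n) N ∙ ∏< δₖ⁻¹ N
      ≡⟨ cong (_∙ ∏< δₖ⁻¹ N) (∏<-distrib-∙ δᵢ δⱼ N) ⟩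
    ∏< δᵢ N ∙ ∏< δⱼ N ∙ ∏< δₖ⁻¹ N
      ≡⟨ cong₂ (λ a b → a ∙ b ∙ ∏< δₖ⁻¹ N) (∏<-onlyAt i id N (s≤s i≤m)) (∏<-onlyAt j id N (s≤s j≤m)) ⟩
    i ∙ j ∙ ∏< δₖ⁻¹ N
      ≡⟨ cong (i ∙ j ∙_) (∏<-onlyAt k _⁻¹ N (s≤s k≤m)) ⟩
    i ∙ j ∙ k ⁻¹
      ∎
    where
    open ≡-Reasoning
    N : ℕ
    N = bound (relator i j k)
    δᵢ δⱼ δₖ⁻¹ : ℕ → ℕ
    δᵢ = onlyAt i id
    δⱼ = onlyAt j id
    δₖ⁻¹ = onlyAt k _⁻¹

  relator∈Φ⇔ : ∀ i j k → Φ A hA (relator i j k) ⇔ (A i j ≡ k)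
  relator∈Φ⇔ i j k = mk⇔
    (λ ijk⁻¹≡ε → x∙y⁻¹≈ε⇒x≈y _ _ (trans (sym (prod-relator i j k)) ijk⁻¹≡ε))
    (λ ij≡k → trans (prod-relator i j k) (x≈y⇒x∙y⁻¹≈ε ij≡k))

-- The entries of A read while computing powers and products in Ã.
module _ {A : Table} (hA : IsAbTable A) where

  powℕ-entries : ℕ → ℕ → List (ℕ × ℕ)
  powℕ-entries g zero    = []
  powℕ-entries g (suc m) = (powℕ A hA g m , g) ∷ powℕ-entries g m

  -- The entry g · g⁻¹ = 1 pins down the inverse of g.
  pow-entries : ℕ → ℤ → List (ℕ × ℕ)
  pow-entries g (+ m)    = powℕ-entries g m
  pow-entries g -[1+ m ] = (g , inv A hA g) ∷ powℕ-entries (inv A hA g) (suc m)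

  prodUpTo-entries : (ℕ → ℤ) → ℕ → List (ℕ × ℕ)
  prodUpTo-entries x zero    = []
  prodUpTo-entries x (suc N) =
    (prodUpTo A hA x N , pow A hA N (x N)) ∷ (pow-entries N (x N) ++ prodUpTo-entries x N)

  prod-entries : FinSupp → List (ℕ × ℕ)
  prod-entries x = prodUpTo-entries (fn x) (bound x)

  module _ {B : Table} (hB : IsAbTable B) where

    open GroupProperties (AbelianGroup.group (abelianGroup hB)) using (inverseʳ-unique)

    powℕ-local : ∀ g m → AgreeOn (powℕ-entries g m) A B → powℕ A hA g m ≡ powℕ B hB g m
    powℕ-local g zero    []       = refl
    powℕ-local g (suc m) (e ∷ es) = trans e (cong (λ a → B a g) (powℕ-local g m es))

    pow-local : ∀ g k → AgreeOn (pow-entries g k) A B → pow A hA g k ≡ pow B hB g k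
    pow-local g (+ m)    es       = powℕ-local g m es
    pow-local g -[1+ m ] (e ∷ es) = trans (powℕ-local (inv A hA g) (suc m) es)
                                          (cong (λ h → powℕ B hB h (suc m)) inv-agrees)
      where
      inv-agrees : inv A hA g ≡ inv B hB g
      inv-agrees = inverseʳ-unique g _ (trans (sym e) (proj₁ (proj₂ (IsAbTable.inverse hA g))))

    prodUpTo-local : ∀ x N → AgreeOn (prodUpTo-entries x N) A B →
                     prodUpTo A hA x N ≡ prodUpTo B hB x N
    prodUpTo-local x zero    []       = refl
    prodUpTo-local x (suc N) (e ∷ es) = trans e (cong₂ B
      (prodUpTo-local x N (++⁻ʳ (pow-entries N (x N)) es))
      (pow-local N (x N) (++⁻ˡ (pow-entries N (x N)) es)))

    Φ-local : ∀ x → AgreeOn (prod-entries x) A B → Φ A hA x ⇔ Φ B hB x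
    Φ-local x es = mk⇔ (trans (sym prod≡)) (trans prod≡)
      where
      prod≡ : prod A hA x ≡ prod B hB x
      prod≡ = prodUpTo-local (fn x) (bound x) es

Φ-continuous : PhiContinuous
Φ-continuous (A , hA) xs = concatMap (prod-entries hA) xs , λ { (B , hB) es →
  All.map (λ {x} → Φ-local hA hB x) (map⁻ (concat⁻ es)) }

entry-determined-by-Φ : ∀ {A B} (hA : IsAbTable A) (hB : IsAbTable B) i j →
  (Φ A hA (relator i j (A i j)) ⇔ Φ B hB (relator i j (A i j))) → A i j ≡ B i j
entry-determined-by-Φ {A} hA hB i j Φ-agree =
  sym (Equivalence.to (relator∈Φ⇔ hB i j (A i j))
        (Equivalence.to Φ-agree (Equivalence.from (relator∈Φ⇔ hA i j (A i j)) refl)))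

Φ-injective : PhiInjective
Φ-injective (A , hA) (B , hB) Φ-agree i j =
  entry-determined-by-Φ hA hB i j (Φ-agree (relator i j (A i j)))

Φ⁻¹-continuous : PhiInverseContinuous
Φ⁻¹-continuous (A , hA) ps = map (λ (i , j) → relator i j (A i j)) ps , λ { (B , hB) Φ-agree →
  All.map (λ {(i , j)} → entry-determined-by-Φ hA hB i j) (map⁻ Φ-agree) }

proposition4p19 : IsTopEmbeddingΦ
proposition4p19 = Φ-injective , Φ-continuous , Φ⁻¹-continuous
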